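{- Let $(2n)!!=\prod_{i=1}^n(2i)$, $(2n-1)!!=\prod_{i=1}^n(2i-1)$ for $n\ge1$, and $0!!=1$. Writing $P(x)|_{x^k}$ for the coefficient of $x^k$ in a polynomial $P$: (1) for all $n\ge1$, $A_{2n}(x)|_{x^k}=0$ for $0\le k<n$ and $A_{2n}(x)|_{x^n}=(2n-1)!!$; (2) for all $n\ge1$, $B_{2n+1}(x)|_{x^k}=0$ for $0\le k<n$ and $B_{2n+1}(x)|_{x^n}=(2n)!!$; (3) for all $n\ge1$, $C_{2n}(x)|_{x^k}=0$ for $0\le k<n-1$ and $C_{2n}(x)|_{x^{n-1}}=(2(n-1))!!$; (4) for all $n\ge1$, $D_{2n+1}(x)|_{x^k}=0$ for $0\le k<n$ and $D_{2n+1}(x)|_{x^n}=(2n-1)!!$.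
   Context: For $\sigma=\sigma_1\ldots\sigma_n\in S_n$, let $\mathrm{mmp}^{(1,0,0,0)}(\sigma)$ be the number of indices $i$ such that there exists $j>i$ with $\sigma_j>\sigma_i$. $UD_n$ is the set of up-down permutations in $S_n$ ($\sigma_1<\sigma_2>\sigma_3<\cdots$) and $DU_n$ the set of down-up permutations ($\sigma_1>\sigma_2<\sigma_3>\cdots$). For $m\ge1$: $A_{2m}(x)=\sum_{\sigma\in UD_{2m}}x^{\mathrm{mmp}^{(1,0,0,0)}(\sigma)}$, $B_{2m-1}(x)=\sum_{\sigma\in UD_{2m-1}}x^{\mathrm{mmp}^{(1,0,0,0)}(\sigma)}$, $C_{2m}(x)=\sum_{\sigma\in DU_{2m}}x^{\mathrm{mmp}^{(1,0,0,0)}(\sigma)}$, $D_{2m-1}(x)=\sum_{\sigma\in DU_{2m-1}}x^{\mathrm{mmp}^{(1,0,0,0)}(\sigma)}$. -}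

module Defs where

open import Data.Nat using (ℕ; zero; suc; _+_; _*_; _<ᵇ_)
open import Data.Nat.Properties using (_≟_)
open import Data.Bool using (Bool; true; false; _∧_; not; T?)
open import Data.List using (List; []; _∷_; length; map; concatMap; filter; upTo)
open import Data.Bool.ListAction using (any)
open import Relation.Nullary.Decidable using (does)

words : ℕ → ℕ → List (List ℕ)
words n zero = [] ∷ []
words n (suc m) = concatMap (λ a → map (a ∷_) (words n m)) (map suc (upTo n))

distinct : List ℕ → Bool
distinct [] = true
distinct (a ∷ l) = not (any (λ b → does (a ≟ b)) l) ∧ distinct l

-- S_n in one-line notation σ₁…σₙ: words of length n over {1,…,n} with distinct letters.
perms : ℕ → List (List ℕ)
perms n = filter (λ w → T? (distinct w)) (words n n)

upDown downUp : List ℕ → Bool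
upDown [] = true
upDown (a ∷ []) = true
upDown (a ∷ b ∷ l) = (a <ᵇ b) ∧ downUp (b ∷ l)
downUp [] = true
downUp (a ∷ []) = true
downUp (a ∷ b ∷ l) = (b <ᵇ a) ∧ upDown (b ∷ l)

-- mmp^{(1,0,0,0)}(σ): number of indices i such that some j > i has σ_j > σ_i.
mmp : List ℕ → ℕ
mmp [] = 0
mmp (a ∷ l) = (if any (λ b → a <ᵇ b) l then 1 else 0) + mmp l
  where open import Data.Bool using (if_then_else_)

-- Coefficient of x^k in  Σ_{σ ∈ S_n, P σ} x^{mmp σ}.
coeff : (List ℕ → Bool) → ℕ → ℕ → ℕ
coeff P n k = length (filter (λ σ → T? (P σ)) (filter (λ σ → mmp σ ≟ k) (perms n)))

-- A_{2m}, B_{2m-1} use up-down permutations; C_{2m}, D_{2m-1} use down-up ones.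
-- A-coefficient of x^k of A_{2m}(x) is  coeff upDown (2m) k,  etc.

evenDF : ℕ → ℕ
evenDF zero = 1
evenDF (suc n) = (2 * suc n) * evenDF n

oddDF : ℕ → ℕ
oddDF zero = 1
oddDF (suc n) = suc (2 * n) * oddDF n

module Submission where

-- In an up-down word every ascent σᵢ < σᵢ₊₁ is counted by mmp, so mmp ≥ ⌊L/2⌋ on UD_L and
-- mmp ≥ ⌊(L-1)/2⌋ on DU_L. Equality holds exactly when every peak exceeds all letters after it.
-- Such a down-up permutation must start with its largest letter and continue with a minimal
-- up-down one; a minimal up-down permutation has its largest letter in second position and an
-- arbitrary first letter. Hence the minimal up-down permutations of length L number
-- (L-1)·(L-3)!! = (L-1)!!, and the minimal down-up ones (L-2)!!.

open import Defs
open import Data.Bool using (Bool; true; false; T; T?; not; _∧_; _∨_; if_then_else_)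
open import Data.Bool.Properties using (if-cong; if-cong-then; ∧-commutativeMonoid; ∧-identityʳ; T-∧; T-≡; T-not-≡)
open import Data.Bool.ListAction using (all; any)
open import Data.Empty using (⊥-elim)
open import Data.Unit using (tt)
open import Data.List using (List; []; _∷_; _++_; length; map; concatMap; filter; upTo)
open import Data.List.Membership.Propositional using (_∈_; _∉_)
open import Data.List.Membership.Propositional.Properties using (∈-filter⁺; ∈-filter⁻)
open import Data.List.Relation.Unary.All as All using (All; []; _∷_)
open import Data.List.Relation.Unary.All.Properties using (All¬⇒¬Any)
open import Data.List.Relation.Unary.AllPairs using ([]; _∷_)
open import Data.List.Relation.Unary.Any using (here; there)
open import Data.List.Relation.Unary.Unique.Propositional using (Unique)
open import Data.List.Relation.Unary.Unique.Propositional.Properties using (map⁺; upTo⁺)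
open import Data.List.Properties using (map-cong; map-cong-local; length-map; length-upTo)
open import Data.List.Extrema.Nat using (max; ⊥≤max; xs≤max; argmax-sel)
open import Data.Nat using (ℕ; zero; suc; _+_; _*_; _∸_; _≤_; _<_; _<ᵇ_; _≡ᵇ_; z≤n; s≤s; z<s; ⌊_/2⌋)
open import Data.Nat.ListAction using (sum)
open import Data.Nat.Properties
import Algebra.Solver.CommutativeMonoid as CommutativeMonoidSolver
open import Data.Product using (∃; _×_; _,_; proj₁; proj₂)
open import Data.Sum using ([_,_]′)
open import Function using (id; _∘_; Equivalence)
open import Relation.Nullary.Decidable using (does; dec-true; dec-false)
open import Relation.Unary using (Decidable)
open import Relation.Binary.PropositionalEquality
open import Relation.Nullary using (¬_; yes; no)

private
  variable
    A B : Set

countᵇ : (A → Bool) → List A → ℕ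
countᵇ p [] = 0
countᵇ p (x ∷ xs) = if p x then suc (countᵇ p xs) else countᵇ p xs

length-filter : {P : A → Set} (P? : Decidable P) (xs : List A) →
                length (filter P? xs) ≡ countᵇ (does ∘ P?) xs
length-filter P? [] = refl
length-filter P? (x ∷ xs) with does (P? x)
... | true  = cong suc (length-filter P? xs)
... | false = length-filter P? xs

countᵇ-filter : {P : A → Set} (P? : Decidable P) (p : A → Bool) (xs : List A) →
                countᵇ p (filter P? xs) ≡ countᵇ (λ x → does (P? x) ∧ p x) xs
countᵇ-filter P? p [] = refl
countᵇ-filter P? p (x ∷ xs) with does (P? x)
... | true  = cong (λ n → if p x then suc n else n) (countᵇ-filter P? p xs)
... | false = countᵇ-filter P? p xs

countᵇ-++ : (p : A → Bool) (xs ys : List A) → countᵇ p (xs ++ ys) ≡ countᵇ p xs + countᵇ p ys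
countᵇ-++ p [] ys = refl
countᵇ-++ p (x ∷ xs) ys with p x
... | true  = cong suc (countᵇ-++ p xs ys)
... | false = countᵇ-++ p xs ys

countᵇ-map : (p : B → Bool) (f : A → B) (xs : List A) → countᵇ p (map f xs) ≡ countᵇ (p ∘ f) xs
countᵇ-map p f [] = refl
countᵇ-map p f (x ∷ xs) with p (f x)
... | true  = cong suc (countᵇ-map p f xs)
... | false = countᵇ-map p f xs

countᵇ-concatMap : (p : B → Bool) (f : A → List B) (xs : List A) →
                   countᵇ p (concatMap f xs) ≡ sum (map (countᵇ p ∘ f) xs)
countᵇ-concatMap p f [] = refl
countᵇ-concatMap p f (x ∷ xs) =
  trans (countᵇ-++ p (f x) (concatMap f xs)) (cong (countᵇ p (f x) +_) (countᵇ-concatMap p f xs))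

countᵇ-false : (xs : List A) → countᵇ (λ _ → false) xs ≡ 0
countᵇ-false [] = refl
countᵇ-false (x ∷ xs) = countᵇ-false xs

countᵇ-∧ˡ : (c : Bool) (p : A → Bool) (xs : List A) →
            countᵇ (λ x → c ∧ p x) xs ≡ (if c then countᵇ p xs else 0)
countᵇ-∧ˡ true  p xs = refl
countᵇ-∧ˡ false p xs = countᵇ-false xs

countᵇ-mono : (p q : A → Bool) (xs : List A) → (∀ {x} → x ∈ xs → T (p x) → T (q x)) →
              countᵇ p xs ≤ countᵇ q xs
countᵇ-mono p q [] p⇒q = z≤n
countᵇ-mono p q (x ∷ xs) p⇒q with p x | q x | p⇒q (here refl)
... | true  | true  | _  = s≤s (countᵇ-mono p q xs (p⇒q ∘ there))
... | false | true  | _  = m≤n⇒m≤1+n (countᵇ-mono p q xs (p⇒q ∘ there))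
... | false | false | _  = countᵇ-mono p q xs (p⇒q ∘ there)
... | true  | false | pq = ⊥-elim (pq _)

if-then-0 : (c : Bool) {n : ℕ} → (T c → n ≡ 0) → (if c then n else 0) ≡ 0
if-then-0 true  n≡0 = n≡0 _
if-then-0 false n≡0 = refl

T⇔T⇒≡ : {x y : Bool} → (T x → T y) → (T y → T x) → x ≡ y
T⇔T⇒≡ {true}  {true}  _ _ = refl
T⇔T⇒≡ {true}  {false} x⇒y _ = ⊥-elim (x⇒y _)
T⇔T⇒≡ {false} {true}  _ y⇒x = ⊥-elim (y⇒x _)
T⇔T⇒≡ {false} {false} _ _ = refl

_─_ : (ℕ → Bool) → ℕ → ℕ → Bool
(p ─ a) x = p x ∧ not (does (a ≟ x))

─-intro : {p : ℕ → Bool} {a x : ℕ} → T (p x) → a ≢ x → T ((p ─ a) x)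
─-intro {a = a} {x} px a≢x = Equivalence.from T-∧ (px , Equivalence.from T-not-≡ (dec-false (a ≟ x) a≢x))

─-elim : {p : ℕ → Bool} {a x : ℕ} → T ((p ─ a) x) → T (p x) × a ≢ x
─-elim {a = a} {x} t with px , a≉x ← Equivalence.to T-∧ t =
  px , λ a≡x → subst (T ∘ not) (dec-true (a ≟ x) a≡x) a≉x

countᵇ-─-∉ : (p : ℕ → Bool) {a : ℕ} {xs : List ℕ} → a ∉ xs → countᵇ (p ─ a) xs ≡ countᵇ p xs
countᵇ-─-∉ p {a} {xs} a∉xs = ≤-antisym
  (countᵇ-mono _ _ xs (λ _ → proj₁ ∘ ─-elim {p} {a}))
  (countᵇ-mono _ _ xs (λ x∈xs px → ─-intro {p} {a} px (λ { refl → a∉xs x∈xs })))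

countᵇ-─ : (p : ℕ → Bool) {a : ℕ} {xs : List ℕ} → Unique xs → a ∈ xs → T (p a) →
           suc (countᵇ (p ─ a) xs) ≡ countᵇ p xs
countᵇ-─ p {a} (a∉ ∷ _) (here refl) pa rewrite dec-true (a ≟ a) refl with p a
... | true = cong suc (countᵇ-─-∉ p (All¬⇒¬Any a∉))
countᵇ-─ p {a} {x ∷ xs} (x∉ ∷ u) (there a∈xs) pa
  rewrite dec-false (a ≟ x) (λ { refl → All¬⇒¬Any x∉ a∈xs }) | ∧-identityʳ (p x) with p x
... | true  = cong suc (countᵇ-─ p u a∈xs pa)
... | false = countᵇ-─ p u a∈xs pa

sum-map-indicator : (p : A → Bool) (c : ℕ) (xs : List A) →
                    sum (map (λ x → if p x then c else 0) xs) ≡ countᵇ p xs * c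
sum-map-indicator p c [] = refl
sum-map-indicator p c (x ∷ xs) with p x
... | true  = cong (c +_) (sum-map-indicator p c xs)
... | false = sum-map-indicator p c xs

sum-map-zero : (f : A → ℕ) {xs : List A} → (∀ {x} → x ∈ xs → f x ≡ 0) → sum (map f xs) ≡ 0
sum-map-zero f {[]} f≡0 = refl
sum-map-zero f {x ∷ xs} f≡0 = cong₂ _+_ (f≡0 (here refl)) (sum-map-zero f (f≡0 ∘ there))

sum-map-single : (f : ℕ → ℕ) {y : ℕ} {xs : List ℕ} → Unique xs → y ∈ xs →
                 (∀ {x} → x ∈ xs → x ≢ y → f x ≡ 0) → sum (map f xs) ≡ f y
sum-map-single f (y∉ ∷ _) (here refl) f≡0 =
  trans (cong (f _ +_) (sum-map-zero f (λ x∈xs → f≡0 (there x∈xs) λ { refl → All¬⇒¬Any y∉ x∈xs })))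
        (+-identityʳ _)
sum-map-single f (x∉ ∷ u) (there y∈xs) f≡0 =
  cong₂ _+_ (f≡0 (here refl) λ { refl → All¬⇒¬Any x∉ y∈xs }) (sum-map-single f u y∈xs (f≡0 ∘ there))

nonempty-max : (ys : List ℕ) → 0 < length ys → ∃ λ m → m ∈ ys × All (_≤ m) ys
nonempty-max (y ∷ ys) _ = max y ys , [ here , there ]′ (argmax-sel id y ys) , ⊥≤max y ys ∷ xs≤max y ys

IsMaxOf : (ℕ → Bool) → List ℕ → ℕ → Set
IsMaxOf p xs m = m ∈ xs × T (p m) × (∀ {x} → x ∈ xs → T (p x) → x ≤ m)

IsMaxOf-─ : {p : ℕ → Bool} {xs : List ℕ} {a m : ℕ} → IsMaxOf p xs m → a ≢ m → IsMaxOf (p ─ a) xs m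
IsMaxOf-─ {p} {a = a} (m∈ , pm , ≤m) a≢m = m∈ , ─-intro {p} pm a≢m , λ x∈ t → ≤m x∈ (proj₁ (─-elim {p} {a} t))

maximum-exists : (p : ℕ → Bool) (xs : List ℕ) → 0 < countᵇ p xs → ∃ (IsMaxOf p xs)
maximum-exists p xs 0<∣p∣
  with m , m∈ , ≤m ← nonempty-max (filter (T? ∘ p) xs) (subst (0 <_) (sym (length-filter (T? ∘ p) xs)) 0<∣p∣)
  with m∈xs , pm ← ∈-filter⁻ (T? ∘ p) {xs = xs} m∈
  = m , m∈xs , pm , λ x∈xs px → All.lookup ≤m (∈-filter⁺ (T? ∘ p) x∈xs px)

_∩_ : (ℕ → Bool) → (ℕ → Bool) → ℕ → Bool
(p ∩ q) x = p x ∧ q x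

module ∧-Solver = CommutativeMonoidSolver ∧-commutativeMonoid
open ∧-Solver using (solve; _⊜_; _⊕_)

all-∩ : (p q : ℕ → Bool) (w : List ℕ) → all (p ∩ q) w ≡ all p w ∧ all q w
all-∩ p q [] = refl
all-∩ p q (x ∷ w) = trans (cong ((p x ∧ q x) ∧_) (all-∩ p q w))
  (solve 4 (λ a b c d → (a ⊕ b) ⊕ (c ⊕ d) ⊜ (a ⊕ c) ⊕ (b ⊕ d)) refl (p x) (q x) (all p w) (all q w))

all-not : (f : ℕ → Bool) (w : List ℕ) → all (not ∘ f) w ≡ not (any f w)
all-not f [] = refl
all-not f (x ∷ w) with f x
... | true  = refl
... | false = all-not f w

distinctOver : (ℕ → Bool) → List ℕ → Bool
distinctOver p w = all p w ∧ distinct w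

distinctOver-∷ : (p : ℕ → Bool) (a : ℕ) (w : List ℕ) →
                 distinctOver p (a ∷ w) ≡ p a ∧ distinctOver (p ─ a) w
distinctOver-∷ p a w = begin
  (p a ∧ all p w) ∧ (not new ∧ distinct w)     ≡⟨ solve 4 (λ x y z d → (x ⊕ y) ⊕ (z ⊕ d) ⊜ x ⊕ ((y ⊕ z) ⊕ d)) refl
                                                      (p a) (all p w) (not new) (distinct w) ⟩
  p a ∧ ((all p w ∧ not new) ∧ distinct w)     ≡⟨ cong (λ b → p a ∧ ((all p w ∧ b) ∧ distinct w)) (sym (all-not _ w)) ⟩
  p a ∧ ((all p w ∧ all fresh w) ∧ distinct w) ≡⟨ cong (λ b → p a ∧ (b ∧ distinct w)) (sym (all-∩ p fresh w)) ⟩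
  p a ∧ distinctOver (p ─ a) w                 ∎
  where
  open ≡-Reasoning
  new : Bool
  new = any (λ b → does (a ≟ b)) w
  fresh : ℕ → Bool
  fresh b = not (does (a ≟ b))

distinctOver-∩ : (p q : ℕ → Bool) (w : List ℕ) (r : Bool) →
                 distinctOver p w ∧ (all q w ∧ r) ≡ distinctOver (p ∩ q) w ∧ r
distinctOver-∩ p q w r = begin
  (all p w ∧ distinct w) ∧ (all q w ∧ r)  ≡⟨ solve 4 (λ x d y z → (x ⊕ d) ⊕ (y ⊕ z) ⊜ ((x ⊕ y) ⊕ d) ⊕ z) refl
                                                 (all p w) (distinct w) (all q w) r ⟩
  ((all p w ∧ all q w) ∧ distinct w) ∧ r  ≡⟨ cong (λ b → (b ∧ distinct w) ∧ r) (sym (all-∩ p q w)) ⟩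
  distinctOver (p ∩ q) w ∧ r              ∎
  where open ≡-Reasoning

module Arrangements (N : ℕ) where

  letters : List ℕ
  letters = map suc (upTo N)

  letters-unique : Unique letters
  letters-unique = map⁺ suc-injective (upTo⁺ N)

  ∣_∣ : (ℕ → Bool) → ℕ
  ∣ p ∣ = countᵇ p letters

  ∣─∣ : (p : ℕ → Bool) {a : ℕ} → a ∈ letters → T (p a) → suc ∣ p ─ a ∣ ≡ ∣ p ∣
  ∣─∣ p = countᵇ-─ p letters-unique

  countWords : ℕ → (List ℕ → Bool) → ℕ
  countWords m p = countᵇ p (words N m)

  countWords-suc : (m : ℕ) (p : List ℕ → Bool) →
                   countWords (suc m) p ≡ sum (map (λ a → countWords m (p ∘ (a ∷_))) letters)
  countWords-suc m p = trans (countᵇ-concatMap p (λ a → map (a ∷_) (words N m)) letters)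
                             (cong sum (map-cong (λ a → countᵇ-map p (a ∷_) (words N m)) letters))

  countWords-cong : (m : ℕ) {p q : List ℕ → Bool} → (∀ w → length w ≡ m → p w ≡ q w) →
                    countWords m p ≡ countWords m q
  countWords-cong zero p≡q rewrite p≡q [] refl = refl
  countWords-cong (suc m) {p} {q} p≡q = begin
    countWords (suc m) p                                  ≡⟨ countWords-suc m p ⟩
    sum (map (λ a → countWords m (p ∘ (a ∷_))) letters)  ≡⟨ cong sum (map-cong (λ a →
                                                              countWords-cong m (λ w → p≡q (a ∷ w) ∘ cong suc)) letters) ⟩
    sum (map (λ a → countWords m (q ∘ (a ∷_))) letters)  ≡⟨ countWords-suc m q ⟨
    countWords (suc m) q                                  ∎
    where open ≡-Reasoning

  countWords-none : (m : ℕ) (p : List ℕ → Bool) → (∀ w → length w ≡ m → ¬ T (p w)) →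
                    countWords m p ≡ 0
  countWords-none m p ¬p =
    trans (countWords-cong m (λ w ∣w∣≡m → ¬T⇒≡false (¬p w ∣w∣≡m))) (countᵇ-false (words N m))
    where
    ¬T⇒≡false : {b : Bool} → ¬ T b → b ≡ false
    ¬T⇒≡false {false} _ = refl
    ¬T⇒≡false {true} ¬t = ⊥-elim (¬t _)

  arrangements : ℕ → (ℕ → Bool) → (List ℕ → Bool) → ℕ
  arrangements m av R = countWords m (λ w → distinctOver av w ∧ R w)

  arrangements-∧ˡ : (m : ℕ) (av : ℕ → Bool) (c : Bool) (R : List ℕ → Bool) →
                    arrangements m av (λ w → c ∧ R w) ≡ (if c then arrangements m av R else 0)
  arrangements-∧ˡ m av c R = trans
    (countWords-cong m (λ w _ → solve 3 (λ x y z → x ⊕ (y ⊕ z) ⊜ y ⊕ (x ⊕ z)) refl (distinctOver av w) c (R w)))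
    (countᵇ-∧ˡ c _ (words N m))

  arrangements-all : (m : ℕ) (av q : ℕ → Bool) (R : List ℕ → Bool) →
                     arrangements m av (λ w → all q w ∧ R w) ≡ arrangements m (av ∩ q) R
  arrangements-all m av q R = countWords-cong m (λ w _ → distinctOver-∩ av q w (R w))

  arrangements-suc : (m : ℕ) (av : ℕ → Bool) (R : List ℕ → Bool) →
                     arrangements (suc m) av R ≡
                     sum (map (λ a → if av a then arrangements m (av ─ a) (R ∘ (a ∷_)) else 0) letters)
  arrangements-suc m av R = trans (countWords-suc m _) (cong sum (map-cong (λ a →
    trans (countWords-cong m (λ w _ → trans (cong (_∧ R (a ∷ w)) (distinctOver-∷ av a w))
             (solve 3 (λ x y z → (x ⊕ y) ⊕ z ⊜ y ⊕ (x ⊕ z)) refl (av a) (distinctOver (av ─ a) w) (R (a ∷ w)))))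
          (arrangements-∧ˡ m (av ─ a) (av a) (R ∘ (a ∷_)))) letters))

  arrangements-pigeonhole : (m : ℕ) (av : ℕ → Bool) (R : List ℕ → Bool) →
                            ∣ av ∣ < m → arrangements m av R ≡ 0
  arrangements-pigeonhole (suc m) av R ∣av∣<1+m =
    trans (arrangements-suc m av R) (sum-map-zero _ vanishes)
    where
    vanishes : ∀ {a} → a ∈ letters → (if av a then arrangements m (av ─ a) (R ∘ (a ∷_)) else 0) ≡ 0
    vanishes {a} a∈ with av a in eq
    ... | false = refl
    ... | true  = arrangements-pigeonhole m (av ─ a) (R ∘ (a ∷_))
                    (subst (_≤ m) (sym (∣─∣ av a∈ (Equivalence.from T-≡ eq))) (≤-pred ∣av∣<1+m))

_!! : ℕ → ℕ
zero !! = 1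
suc zero !! = 1
suc (suc n) !! = suc (suc n) * n !!

!!-suc : (m : ℕ) → suc m !! ≡ suc m * (m ∸ 1) !!
!!-suc zero = refl
!!-suc (suc m) = refl

evenDF≡!! : (n : ℕ) → evenDF n ≡ (2 * n) !!
evenDF≡!! zero = refl
evenDF≡!! (suc n) = trans (cong₂ _*_ (*-suc 2 n) (evenDF≡!! n)) (cong _!! (sym (*-suc 2 n)))

oddDF≡!! : (n : ℕ) → oddDF n ≡ (2 * n ∸ 1) !!
oddDF≡!! zero = refl
oddDF≡!! (suc n) = trans (cong (suc (2 * n) *_) (oddDF≡!! n))
  (trans (sym (!!-suc (2 * n))) (cong (λ m → (m ∸ 1) !!) (sym (*-suc 2 n))))

headSatisfies : (ℕ → Bool) → List ℕ → Bool
headSatisfies h [] = true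
headSatisfies h (b ∷ _) = h b

-- The up-down (resp. down-up) words of minimal mmp: every peak exceeds all later letters.
minUpDown minDownUp : List ℕ → Bool
minUpDown [] = true
minUpDown (a ∷ w) = headSatisfies (a <ᵇ_) w ∧ minDownUp w
minDownUp [] = true
minDownUp (a ∷ w) = all (_<ᵇ a) w ∧ minUpDown w

module MinimalCounts (N : ℕ) where
  open Arrangements N

  #minUpDown : (m : ℕ) (av : ℕ → Bool) → ∣ av ∣ ≡ m → arrangements m av minUpDown ≡ (m ∸ 1) !!

  #minDownUp : (m : ℕ) (av h : ℕ → Bool) {M : ℕ} → ∣ av ∣ ≡ suc m → IsMaxOf av letters M →
               arrangements (suc m) av (λ w → headSatisfies h w ∧ minDownUp w) ≡
               (if h M then (m ∸ 1) !! else 0)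
  #minDownUp m av h {M} ∣av∣≡1+m (M∈ , avM , ≤M) = begin
    arrangements (suc m) av R                                              ≡⟨ arrangements-suc m av R ⟩
    sum (map (λ b → if av b then arrangements m (av ─ b) (R ∘ (b ∷_)) else 0) letters)
                                                                           ≡⟨ sum-map-single _ letters-unique M∈ others-vanish ⟩
    (if av M then arrangements m (av ─ M) (R ∘ (M ∷_)) else 0)            ≡⟨ if-cong (Equivalence.to T-≡ avM) ⟩
    arrangements m (av ─ M) (R ∘ (M ∷_))                                   ≡⟨ starting-with M ⟩
    (if h M then arrangements m ((av ─ M) ∩ (_<ᵇ M)) minUpDown else 0)    ≡⟨ if-cong-then (h M)
                                                                                (#minUpDown m _ below-M-size) ⟩
    (if h M then (m ∸ 1) !! else 0)                                        ∎
    where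
    open ≡-Reasoning
    R : List ℕ → Bool
    R w = headSatisfies h w ∧ minDownUp w

    starting-with : ∀ b → arrangements m (av ─ b) (R ∘ (b ∷_)) ≡
                          (if h b then arrangements m ((av ─ b) ∩ (_<ᵇ b)) minUpDown else 0)
    starting-with b = trans (arrangements-∧ˡ m (av ─ b) (h b) _)
                            (if-cong-then (h b) (arrangements-all m (av ─ b) (_<ᵇ b) minUpDown))

    below-M-size : ∣ (av ─ M) ∩ (_<ᵇ M) ∣ ≡ m
    below-M-size = suc-injective (trans (cong suc (≤-antisym
      (countᵇ-mono _ _ letters λ _ t → proj₁ (Equivalence.to T-∧ t))
      (countᵇ-mono _ _ letters λ x∈ t → let avx , M≢x = ─-elim {av} {M} t in
                                          Equivalence.from T-∧ (t , <⇒<ᵇ (≤∧≢⇒< (≤M x∈ avx) (M≢x ∘ sym))))))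
      (trans (∣─∣ av M∈ avM) ∣av∣≡1+m))

    below-size< : ∀ {b} → b ∈ letters → T (av b) → b ≢ M → ∣ (av ─ b) ∩ (_<ᵇ b) ∣ < m
    below-size< {b} b∈ avb b≢M = ≤-<-trans
      (countᵇ-mono _ ((av ─ b) ─ M) letters λ x∈ t → let avbx , x<b = Equivalence.to T-∧ t in
         ─-intro {av ─ b} {M} avbx λ M≡x → <-irrefl (sym M≡x) (<-≤-trans (<ᵇ⇒< _ b x<b) (≤M b∈ avb)))
      (≤-reflexive (suc-injective (begin
        suc (suc ∣ (av ─ b) ─ M ∣)  ≡⟨ cong suc (∣─∣ (av ─ b) M∈ (─-intro {av} {b} avM b≢M)) ⟩
        suc ∣ av ─ b ∣              ≡⟨ ∣─∣ av b∈ avb ⟩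
        ∣ av ∣                      ≡⟨ ∣av∣≡1+m ⟩
        suc m                       ∎)))

    others-vanish : ∀ {b} → b ∈ letters → b ≢ M →
                    (if av b then arrangements m (av ─ b) (R ∘ (b ∷_)) else 0) ≡ 0
    others-vanish {b} b∈ b≢M = if-then-0 (av b) λ avb → trans (starting-with b)
      (if-then-0 (h b) λ _ → arrangements-pigeonhole m _ minUpDown (below-size< b∈ avb b≢M))

  #minUpDown zero av _ = refl
  #minUpDown (suc zero) av ∣av∣≡1 = trans (arrangements-suc 0 av minUpDown)
    (trans (sum-map-indicator av 1 letters) (cong (_* 1) ∣av∣≡1))
  #minUpDown (suc (suc m)) av ∣av∣≡2+m
    with M , M∈ , avM , ≤M ← maximum-exists av letters (subst (0 <_) (sym ∣av∣≡2+m) z<s) = begin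
    arrangements (suc (suc m)) av minUpDown                          ≡⟨ arrangements-suc (suc m) av minUpDown ⟩
    sum (map (λ a → if av a then arrangements (suc m) (av ─ a) (minUpDown ∘ (a ∷_)) else 0) letters)
                                                                     ≡⟨ cong sum (map-cong-local (All.tabulate first-letter)) ⟩
    sum (map (λ a → if (av ─ M) a then (m ∸ 1) !! else 0) letters)  ≡⟨ sum-map-indicator (av ─ M) _ letters ⟩
    ∣ av ─ M ∣ * (m ∸ 1) !!                                          ≡⟨ cong (_* (m ∸ 1) !!) (∣─∣≡1+m M∈ avM) ⟩
    suc m * (m ∸ 1) !!                                               ≡⟨ !!-suc m ⟨
    suc m !!                                                         ∎
    where
    open ≡-Reasoning
    ∣─∣≡1+m : ∀ {a} → a ∈ letters → T (av a) → ∣ av ─ a ∣ ≡ suc m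
    ∣─∣≡1+m a∈ ava = suc-injective (trans (∣─∣ av a∈ ava) ∣av∣≡2+m)

    first-letter : ∀ {a} → a ∈ letters →
                   (if av a then arrangements (suc m) (av ─ a) (minUpDown ∘ (a ∷_)) else 0) ≡
                   (if (av ─ M) a then (m ∸ 1) !! else 0)
    first-letter {a} a∈ with av a in ava | a ≟ M
    ... | false | _ = refl
    ... | true | no a≢M = begin
      arrangements (suc m) (av ─ a) (minUpDown ∘ (a ∷_))  ≡⟨ #minDownUp m (av ─ a) (a <ᵇ_) (∣─∣≡1+m a∈ avaT)
                                                                           (IsMaxOf-─ (M∈ , avM , ≤M) a≢M) ⟩
      (if a <ᵇ M then (m ∸ 1) !! else 0)                  ≡⟨ if-cong (Equivalence.to T-≡ (<⇒<ᵇ (≤∧≢⇒< (≤M a∈ avaT) a≢M))) ⟩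
      (m ∸ 1) !!                                           ≡⟨ if-cong (cong not (dec-false (M ≟ a) (a≢M ∘ sym))) ⟨
      (if not (does (M ≟ a)) then (m ∸ 1) !! else 0)      ∎
      where
      avaT : T (av a)
      avaT = Equivalence.from T-≡ ava
    ... | true | yes refl
      with M′ , M′∈ , avM′ , ≤M′ ← maximum-exists (av ─ M) letters (subst (0 <_) (sym (∣─∣≡1+m M∈ avM)) z<s) =
      trans (#minDownUp m (av ─ M) (M <ᵇ_) (∣─∣≡1+m M∈ avM) (M′∈ , avM′ , ≤M′))
            (trans (if-then-0 _ λ M<M′ → ⊥-elim (≤⇒≯ (≤M M′∈ (proj₁ (─-elim {av} {M} avM′))) (<ᵇ⇒< M M′ M<M′)))
                   (sym (if-cong (cong not (dec-true (M ≟ M) refl)))))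

all<⇒¬any> : (a : ℕ) (l : List ℕ) → T (all (_<ᵇ a) l) → any (a <ᵇ_) l ≡ false
all<⇒¬any> a [] _ = refl
all<⇒¬any> a (x ∷ l) t with x<a , l<a ← Equivalence.to T-∧ t with a <ᵇ x in a<x
... | true  = ⊥-elim (<-asym (<ᵇ⇒< x a x<a) (<ᵇ⇒< a x (Equivalence.from T-≡ a<x)))
... | false = all<⇒¬any> a l l<a

¬any>⇒all< : (a : ℕ) (l : List ℕ) → T (not (any (λ b → does (a ≟ b)) l)) → any (a <ᵇ_) l ≡ false →
             T (all (_<ᵇ a) l)
¬any>⇒all< a [] _ _ = tt
¬any>⇒all< a (x ∷ l) a∉ ¬a< with a <ᵇ x in a<x | a ≡ᵇ x in a≡x
¬any>⇒all< a (x ∷ l) a∉ ¬a< | false | false = Equivalence.from T-∧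
  (<⇒<ᵇ (≤∧≢⇒< (≮⇒≥ (λ a<x′ → subst T a<x (<⇒<ᵇ a<x′))) (λ x≡a → subst T a≡x (≡⇒≡ᵇ a x (sym x≡a)))) ,
   ¬any>⇒all< a l a∉ ¬a<)

mmp-ascent : (a b : ℕ) (l : List ℕ) → T (a <ᵇ b) → mmp (a ∷ b ∷ l) ≡ suc (mmp (b ∷ l))
mmp-ascent a b l a<b = cong (_+ mmp (b ∷ l)) (if-cong (cong (_∨ any (a <ᵇ_) l) (Equivalence.to T-≡ a<b)))

mmp-∷-max : (a : ℕ) (l : List ℕ) → T (all (_<ᵇ a) l) → mmp (a ∷ l) ≡ mmp l
mmp-∷-max a l l<a = cong (_+ mmp l) (if-cong (all<⇒¬any> a l l<a))

⌊len/2⌋≤mmp-upDown : (w : List ℕ) → T (upDown w) → ⌊ length w /2⌋ ≤ mmp w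
⌊len∸1/2⌋≤mmp-downUp : (w : List ℕ) → T (downUp w) → ⌊ length w ∸ 1 /2⌋ ≤ mmp w
⌊len/2⌋≤mmp-upDown [] _ = z≤n
⌊len/2⌋≤mmp-upDown (a ∷ []) _ = z≤n
⌊len/2⌋≤mmp-upDown (a ∷ b ∷ l) t =
  let a<b , du = Equivalence.to (T-∧ {a <ᵇ b}) t
  in ≤-trans (s≤s (⌊len∸1/2⌋≤mmp-downUp (b ∷ l) du)) (≤-reflexive (sym (mmp-ascent a b l a<b)))
⌊len∸1/2⌋≤mmp-downUp [] _ = z≤n
⌊len∸1/2⌋≤mmp-downUp (a ∷ []) _ = z≤n
⌊len∸1/2⌋≤mmp-downUp (a ∷ b ∷ l) t =
  ≤-trans (⌊len/2⌋≤mmp-upDown (b ∷ l) (proj₂ (Equivalence.to (T-∧ {b <ᵇ a}) t)))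
          (m≤n+m (mmp (b ∷ l)) (if any (a <ᵇ_) (b ∷ l) then 1 else 0))

minUpDown-attains : (w : List ℕ) → T (minUpDown w) → T (upDown w) × mmp w ≡ ⌊ length w /2⌋
minDownUp-attains : (w : List ℕ) → T (minDownUp w) → T (downUp w) × mmp w ≡ ⌊ length w ∸ 1 /2⌋
minUpDown-attains [] _ = tt , refl
minUpDown-attains (a ∷ []) _ = tt , refl
minUpDown-attains (a ∷ b ∷ l) t =
  let a<b , mdu = Equivalence.to (T-∧ {a <ᵇ b}) t
      du , mmp≡ = minDownUp-attains (b ∷ l) mdu
  in Equivalence.from T-∧ (a<b , du) , trans (mmp-ascent a b l a<b) (cong suc mmp≡)
minDownUp-attains [] _ = tt , refl
minDownUp-attains (a ∷ l) t =
  let l<a , mud = Equivalence.to (T-∧ {all (_<ᵇ a) l}) t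
      ud , mmp≡ = minUpDown-attains l mud
  in downUp-∷ l l<a ud , trans (mmp-∷-max a l l<a) mmp≡
  where
  downUp-∷ : ∀ l → T (all (_<ᵇ a) l) → T (upDown l) → T (downUp (a ∷ l))
  downUp-∷ [] _ _ = tt
  downUp-∷ (b ∷ _) l<a ud = Equivalence.from T-∧ (proj₁ (Equivalence.to (T-∧ {b <ᵇ a}) l<a) , ud)

indicator+n≤n⇒false : (c : Bool) {n : ℕ} → (if c then 1 else 0) + n ≤ n → c ≡ false
indicator+n≤n⇒false true 1+n≤n = ⊥-elim (1+n≰n 1+n≤n)
indicator+n≤n⇒false false _ = refl

distinct-∷ : (a : ℕ) (l : List ℕ) → T (distinct (a ∷ l)) →
             T (not (any (λ b → does (a ≟ b)) l)) × T (distinct l)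
distinct-∷ a l = Equivalence.to (T-∧ {not (any (λ b → does (a ≟ b)) l)})

downUp-tail : (a : ℕ) (l : List ℕ) → T (downUp (a ∷ l)) → T (upDown l)
downUp-tail a [] _ = tt
downUp-tail a (b ∷ l) t = proj₂ (Equivalence.to (T-∧ {b <ᵇ a}) t)

attains-minUpDown : (w : List ℕ) → T (distinct w) → T (upDown w) → mmp w ≡ ⌊ length w /2⌋ →
                    T (minUpDown w)
attains-minDownUp : (w : List ℕ) → T (distinct w) → T (downUp w) → mmp w ≡ ⌊ length w ∸ 1 /2⌋ →
                    T (minDownUp w)
attains-minUpDown [] _ _ _ = tt
attains-minUpDown (a ∷ []) _ _ _ = tt
attains-minUpDown (a ∷ b ∷ l) d t mmp≡ =
  let a<b , du = Equivalence.to (T-∧ {a <ᵇ b}) t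
  in Equivalence.from T-∧ (a<b , attains-minDownUp (b ∷ l) (proj₂ (distinct-∷ a (b ∷ l) d)) du
                                  (suc-injective (trans (sym (mmp-ascent a b l a<b)) mmp≡)))
attains-minDownUp [] _ _ _ = tt
attains-minDownUp (a ∷ l) d t mmp≡ =
  let a∉l , dl = distinct-∷ a l d
      ud = downUp-tail a l t
      noneAbove = indicator+n≤n⇒false (any (a <ᵇ_) l)
                    (≤-trans (≤-reflexive mmp≡) (⌊len/2⌋≤mmp-upDown l ud))
  in Equivalence.from T-∧ (¬any>⇒all< a l a∉l noneAbove ,
                           attains-minUpDown l dl ud (trans (sym (cong (_+ mmp l) (if-cong noneAbove))) mmp≡))

LowestCoeff : (List ℕ → Bool) → ℕ → ℕ → ℕ → Set
LowestCoeff P L d c = (∀ k → k < d → coeff P L k ≡ 0) × coeff P L d ≡ c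

module _ (L : ℕ) where
  open Arrangements L

  coeff≡countWords : (P : List ℕ → Bool) (k : ℕ) →
                     coeff P L k ≡ countWords L (λ w → distinct w ∧ ((mmp w ≡ᵇ k) ∧ P w))
  coeff≡countWords P k = trans (length-filter (T? ∘ P) (filter (λ σ → mmp σ ≟ k) (perms L)))
    (trans (countᵇ-filter (λ σ → mmp σ ≟ k) P (perms L)) (countᵇ-filter (T? ∘ distinct) _ (words L L)))

  coeff-below : (P : List ℕ → Bool) (d : ℕ) → (∀ w → length w ≡ L → T (P w) → d ≤ mmp w) →
                ∀ k → k < d → coeff P L k ≡ 0
  coeff-below P d d≤mmp k k<d = trans (coeff≡countWords P k) (countWords-none L _ λ w ∣w∣≡L t →
    let _ , mmpP = Equivalence.to (T-∧ {distinct w}) t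
        mmp≡k , Pw = Equivalence.to (T-∧ {mmp w ≡ᵇ k}) mmpP
    in <⇒≱ k<d (subst (d ≤_) (≡ᵇ⇒≡ (mmp w) k mmp≡k) (d≤mmp w ∣w∣≡L Pw)))

  coeff-at-minimum : (P Q : List ℕ → Bool) (d : ℕ) →
                  (∀ w → length w ≡ L → T (distinct w) → T (P w) → mmp w ≡ d → T (Q w)) →
                  (∀ w → length w ≡ L → T (Q w) → T (P w) × mmp w ≡ d) →
                  coeff P L d ≡ arrangements L (λ _ → true) Q
  coeff-at-minimum P Q d attains⇒Q Q⇒attains = trans (coeff≡countWords P d) (countWords-cong L λ w ∣w∣≡L →
    T⇔T⇒≡ (λ t → let dw , mmpP = Equivalence.to (T-∧ {distinct w}) t
                     mmp≡d , Pw = Equivalence.to (T-∧ {mmp w ≡ᵇ d}) mmpP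
                 in Equivalence.from T-∧ (Equivalence.from T-∧ (all-true w , dw) ,
                                          attains⇒Q w ∣w∣≡L dw Pw (≡ᵇ⇒≡ (mmp w) d mmp≡d)))
          (λ t → let dOw , Qw = Equivalence.to (T-∧ {distinctOver (λ _ → true) w}) t
                     Pw , mmp≡d = Q⇒attains w ∣w∣≡L Qw
                 in Equivalence.from T-∧ (proj₂ (Equivalence.to (T-∧ {all (λ _ → true) w}) dOw) ,
                                          Equivalence.from T-∧ (≡⇒≡ᵇ (mmp w) d mmp≡d , Pw))))
    where
    all-true : ∀ w → T (all (λ _ → true) w)
    all-true [] = tt
    all-true (_ ∷ w) = all-true w

  ∣all∣≡L : ∣ (λ _ → true) ∣ ≡ L
  ∣all∣≡L = trans (countᵇ-true letters) (trans (length-map suc (upTo L)) (length-upTo L))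
    where
    countᵇ-true : (xs : List ℕ) → countᵇ (λ _ → true) xs ≡ length xs
    countᵇ-true [] = refl
    countᵇ-true (_ ∷ xs) = cong suc (countᵇ-true xs)

upDown-lowestCoeff : (L : ℕ) → LowestCoeff upDown L ⌊ L /2⌋ ((L ∸ 1) !!)
upDown-lowestCoeff L =
  coeff-below L upDown ⌊ L /2⌋
    (λ w ∣w∣≡L ud → subst (λ n → ⌊ n /2⌋ ≤ mmp w) ∣w∣≡L (⌊len/2⌋≤mmp-upDown w ud)) ,
  trans (coeff-at-minimum L upDown minUpDown ⌊ L /2⌋
          (λ w ∣w∣≡L dw ud mmp≡ → attains-minUpDown w dw ud (trans mmp≡ (cong ⌊_/2⌋ (sym ∣w∣≡L))))
          (λ w ∣w∣≡L m → let ud , mmp≡ = minUpDown-attains w m in ud , trans mmp≡ (cong ⌊_/2⌋ ∣w∣≡L)))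
        (MinimalCounts.#minUpDown L L (λ _ → true) (∣all∣≡L L))

downUp-lowestCoeff : (L : ℕ) → LowestCoeff downUp L ⌊ L ∸ 1 /2⌋ ((L ∸ 2) !!)
downUp-lowestCoeff zero = (λ _ ()) , refl
downUp-lowestCoeff (suc L) =
  coeff-below (suc L) downUp ⌊ L /2⌋
    (λ w ∣w∣≡1+L du → subst (λ n → ⌊ n ∸ 1 /2⌋ ≤ mmp w) ∣w∣≡1+L (⌊len∸1/2⌋≤mmp-downUp w du)) ,
  trans (coeff-at-minimum (suc L) downUp (λ w → headSatisfies (λ _ → true) w ∧ minDownUp w) ⌊ L /2⌋
          (λ { (b ∷ w) refl dw du mmp≡ → attains-minDownUp (b ∷ w) dw du mmp≡ })
          (λ { (b ∷ w) refl m → minDownUp-attains (b ∷ w) m }))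
        (MinimalCounts.#minDownUp (suc L) L (λ _ → true) (λ _ → true) (∣all∣≡L (suc L)) (proj₂ largest))
  where
  largest : ∃ (IsMaxOf (λ _ → true) (Arrangements.letters (suc L)))
  largest = maximum-exists (λ _ → true) (Arrangements.letters (suc L))
                           (subst (0 <_) (sym (∣all∣≡L (suc L))) z<s)

⌊2*n/2⌋≡n : (n : ℕ) → ⌊ 2 * n /2⌋ ≡ n
⌊2*n/2⌋≡n zero = refl
⌊2*n/2⌋≡n (suc n) = trans (cong ⌊_/2⌋ (*-suc 2 n)) (cong suc (⌊2*n/2⌋≡n n))

⌊1+2*n/2⌋≡n : (n : ℕ) → ⌊ suc (2 * n) /2⌋ ≡ n
⌊1+2*n/2⌋≡n zero = refl
⌊1+2*n/2⌋≡n (suc n) = trans (cong (⌊_/2⌋ ∘ suc) (*-suc 2 n)) (cong suc (⌊1+2*n/2⌋≡n n))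

theorem3p1 : (∀ n → 1 ≤ n →
                 ((∀ k → k < n → coeff upDown (2 * n) k ≡ 0)
                   × coeff upDown (2 * n) n ≡ oddDF n))
             × (∀ n → 1 ≤ n →
                 ((∀ k → k < n → coeff upDown (2 * n + 1) k ≡ 0)
                   × coeff upDown (2 * n + 1) n ≡ evenDF n))
             × (∀ n → 1 ≤ n →
                 ((∀ k → k < n ∸ 1 → coeff downUp (2 * n) k ≡ 0)
                   × coeff downUp (2 * n) (n ∸ 1) ≡ evenDF (n ∸ 1)))
             × (∀ n → 1 ≤ n →
                 ((∀ k → k < n → coeff downUp (2 * n + 1) k ≡ 0)
                   × coeff downUp (2 * n + 1) n ≡ oddDF n))
theorem3p1 =
    (λ n _ → subst₂ (LowestCoeff upDown (2 * n)) (⌊2*n/2⌋≡n n) (sym (oddDF≡!! n)) (upDown-lowestCoeff (2 * n)))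
  , (λ n _ → subst (λ L → LowestCoeff upDown L n (evenDF n)) (+-comm 1 (2 * n))
      (subst₂ (LowestCoeff upDown (suc (2 * n))) (⌊1+2*n/2⌋≡n n) (sym (evenDF≡!! n)) (upDown-lowestCoeff (suc (2 * n)))))
  , (λ { (suc n) _ → subst (λ L → LowestCoeff downUp L n (evenDF n)) (sym (*-suc 2 n))
      (subst₂ (LowestCoeff downUp (2 + 2 * n)) (⌊1+2*n/2⌋≡n n) (sym (evenDF≡!! n)) (downUp-lowestCoeff (2 + 2 * n))) })
  , (λ n _ → subst (λ L → LowestCoeff downUp L n (oddDF n)) (+-comm 1 (2 * n))
      (subst₂ (LowestCoeff downUp (suc (2 * n))) (⌊2*n/2⌋≡n n) (sym (oddDF≡!! n)) (downUp-lowestCoeff (suc (2 * n)))))
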